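{- Let $X$ be a finite nonempty linearly ordered set and let $s=\sigma_X(X)$ be the formal sum of all elements of $X$. Let $A,B\subseteq TX$ be finite sets with $s\in A\cap B$, and suppose there are $x,y\in X$ (not necessarily distinct) such that $A-\{s\}\subseteq T(X-\{x\})$ and $B-\{s\}\subseteq T(X-\{y\})$. If \[\sum_{a\in A}k_a\kappa_X(a)=\sum_{b\in B}l_b\kappa_X(b)\] for some positive reals $k_a$ ($a\in A$), $l_b$ ($b\in B$), then $A-\{s\}\subseteq T(X-\{x,y\})$, $B-\{s\}\subseteq T(X-\{x,y\})$, and $k_s=l_s$.
   Context: For a set $Y$, $TY$ is the free commutative semigroup generated by $Y$: its elements are formal sums $k_1y_1+\ldots+k_ry_r$ with $r\geq1$, distinct $y_j\in Y$ and positive integers $k_j$. For $Z\subseteq X$, $TZ\subseteq TX$ is the set of formal sums involving only elements of $Z$ ($T\emptyset=\emptyset$). $\sigma_X(X)$ denotes the sum of all elements of $X$, each with coefficient $1$. If $X=\{x_1<\ldots<x_d\}$, $\kappa_X:TX\to\mathbb R^d$ maps $\sum_j k_jx_j$ (with $k_j\geq0$, not all $0$) to $(k_1,\ldots,k_d)$. -}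

module Defs where

open import Level using (Level; _⊔_; suc)
open import Algebra.Bundles using (CommutativeRing)
open import Relation.Binary.Core using (Rel)
open import Relation.Binary.Structures using (IsStrictTotalOrder)
open import Relation.Nullary using (¬_)
open import Data.Product using (∃; ∃-syntax)
open import Data.Nat as ℕ using (ℕ; zero) renaming (suc to 1+)
open import Data.Fin using (Fin)
open import Data.Vec using (Vec; lookup; replicate)
open import Data.List using (List; []; _∷_)

-- An ordered field (the abstract structure of the reals relevant here):
-- a commutative ring with a strict total order compatible with + and *,
-- 0 < 1, and multiplicative inverses of nonzero elements.
record OrderedField (c ℓ₁ ℓ₂ : Level) : Set (suc (c ⊔ ℓ₁ ⊔ ℓ₂)) where
  field
    commutativeRing : CommutativeRing c ℓ₁
  open CommutativeRing commutativeRing public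
  field
    _<_                : Rel Carrier ℓ₂
    isStrictTotalOrder : IsStrictTotalOrder _≈_ _<_
    +-monoˡ-<          : ∀ {a b} c → a < b → (a + c) < (b + c)
    *-pos              : ∀ {a b} → 0# < a → 0# < b → 0# < (a * b)
    0<1                : 0# < 1#
    inverse            : ∀ x → ¬ (x ≈ 0#) → ∃[ y ] (x * y ≈ 1#)

module _ {c ℓ₁ ℓ₂} (F : OrderedField c ℓ₁ ℓ₂) where
  open OrderedField F

  ι : ℕ → Carrier
  ι zero   = 0#
  ι (1+ n) = 1# + ι n

  Σ[_]_ : ∀ {A : Set} → List A → (A → Carrier) → Carrier
  Σ[ [] ]     f = 0#
  Σ[ a ∷ as ] f = f a + Σ[ as ] f

-- X = {0 < 1 < ... < d-1} = Fin d.  An element Σ_j k_j x_j of TX is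
-- represented by its coefficient vector κ_X(a) = (k_0,...,k_{d-1}) ∈ ℕ^d,
-- which must be nonzero.
Mon : ℕ → Set
Mon d = Vec ℕ d

InTX : ∀ {d} → Mon d → Set
InTX {d} a = ∃[ i ] (ℕ._≤_ 1 (lookup a i))

σX : ∀ d → Mon d
σX d = replicate d 1

module Submission where

-- Read the equation in coordinate x.  Every a ∈ A other than s has a_x = 0,
-- so the left side is k_s, while the right side is l_s + P with
-- P = Σ_{b ≠ s} l_b b_x ≥ 0.  Symmetrically coordinate y gives
-- l_s = k_s + Q with Q = Σ_{a ≠ s} k_a a_y ≥ 0.  Hence P + Q = 0, so P = Q = 0;
-- as all weights are positive this forces b_x = 0 and a_y = 0, and k_s = l_s.

open import Defs
open import Level using (Level; _⊔_)
open import Relation.Binary.PropositionalEquality using (_≡_; _≢_)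
open import Relation.Nullary using (¬_)
open import Data.Product using (_×_)
open import Data.Nat using (ℕ; zero; suc)
open import Data.Fin using (Fin)
open import Data.Vec using (lookup)
open import Data.List using (List)
open import Data.List.Membership.Propositional using (_∈_)
open import Data.List.Relation.Unary.All using (All)
open import Data.List.Relation.Unary.Unique.Propositional using (Unique)

open import Data.Empty using (⊥-elim)
open import Data.Product using (_,_; proj₁; proj₂)
open import Data.Sum using (_⊎_; inj₁; inj₂)
open import Data.List using (_∷_)
open import Data.List.Relation.Unary.All using ([]; _∷_)
import Data.List.Relation.Unary.All as All
open import Data.List.Relation.Unary.All.Properties using (─⁺)
open import Data.List.Relation.Unary.Any using (here; there; _─_)
open import Data.List.Relation.Unary.AllPairs using (_∷_)
open import Data.Vec.Properties using (lookup-replicate)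
open import Relation.Binary.PropositionalEquality using (refl; ≢-sym)
open import Relation.Binary.Structures using (IsStrictTotalOrder)
import Relation.Binary.Reasoning.Setoid as SetoidReasoning

module _ {A : Set} {P : A → Set} {s : A} where

  Unique⇒All-─ : ∀ {L} → Unique L → (p : s ∈ L) →
                 (∀ a → a ∈ L → a ≢ s → P a) → All P (L ─ p)
  Unique⇒All-─ (s∉L ∷ _) (here refl) h =
    All.tabulate λ {a} m → h a (there m) (≢-sym (All.lookup s∉L m))
  Unique⇒All-─ (b∉L ∷ u) (there p) h =
    h _ (here refl) (All.lookup b∉L p) ∷ Unique⇒All-─ u p (λ a m → h a (there m))

  All-─⇒∀≢ : ∀ {L} (p : s ∈ L) → All P (L ─ p) → ∀ a → a ∈ L → a ≢ s → P a
  All-─⇒∀≢ (here refl) _          a (here refl) a≢s = ⊥-elim (a≢s refl)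
  All-─⇒∀≢ (here refl) ps         a (there m)   _   = All.lookup ps m
  All-─⇒∀≢ (there p)   (pb ∷ _)   a (here refl) _   = pb
  All-─⇒∀≢ (there p)   (_ ∷ ps)   a (there m)   a≢s = All-─⇒∀≢ p ps a m a≢s

module OrderedFieldProperties {c ℓ₁ ℓ₂} (F : OrderedField c ℓ₁ ℓ₂) where
  open OrderedField F renaming (refl to ≈-refl)
  open IsStrictTotalOrder isStrictTotalOrder
    using (irrefl; <-respˡ-≈; <-respʳ-≈) renaming (trans to <-trans)
  open import Algebra.Properties.Group +-group using (∙-cancelˡ)
  open import Algebra.Properties.CommutativeSemigroup +-commutativeSemigroup
    using (x∙yz≈y∙xz)
  open SetoidReasoning setoid

  NonNegative : Carrier → Set (ℓ₁ ⊔ ℓ₂)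
  NonNegative t = 0# < t ⊎ 0# ≈ t

  pos+nonneg⇒pos : ∀ {a b} → 0# < a → NonNegative b → 0# < (a + b)
  pos+nonneg⇒pos {a} pa (inj₂ 0≈b) = <-respʳ-≈ (trans (sym (+-identityʳ a)) (+-congˡ 0≈b)) pa
  pos+nonneg⇒pos {a} {b} pa (inj₁ pb) =
    <-trans pb (<-respˡ-≈ (+-identityˡ b) (+-monoˡ-< b pa))

  nonneg+nonneg⇒nonneg : ∀ {a b} → NonNegative a → NonNegative b → NonNegative (a + b)
  nonneg+nonneg⇒nonneg (inj₁ pa) nb = inj₁ (pos+nonneg⇒pos pa nb)
  nonneg+nonneg⇒nonneg {a} {b} (inj₂ 0≈a) (inj₁ pb) =
    inj₁ (<-respʳ-≈ (+-comm b a) (pos+nonneg⇒pos pb (inj₂ 0≈a)))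
  nonneg+nonneg⇒nonneg (inj₂ 0≈a) (inj₂ 0≈b) =
    inj₂ (trans (sym (+-identityʳ 0#)) (+-cong 0≈a 0≈b))

  nonneg+nonneg≈0⇒ˡ≈0 : ∀ {a b} → NonNegative a → NonNegative b → a + b ≈ 0# → a ≈ 0#
  nonneg+nonneg≈0⇒ˡ≈0 (inj₁ pa) nb a+b≈0 = ⊥-elim (irrefl (sym a+b≈0) (pos+nonneg⇒pos pa nb))
  nonneg+nonneg≈0⇒ˡ≈0 (inj₂ 0≈a) _ _   = sym 0≈a

  nonneg+nonneg≈0⇒ʳ≈0 : ∀ {a b} → NonNegative a → NonNegative b → a + b ≈ 0# → b ≈ 0#
  nonneg+nonneg≈0⇒ʳ≈0 {a} {b} na nb a+b≈0 = nonneg+nonneg≈0⇒ˡ≈0 nb na (trans (+-comm b a) a+b≈0)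

  pos*nonneg⇒nonneg : ∀ {a b} → 0# < a → NonNegative b → NonNegative (a * b)
  pos*nonneg⇒nonneg pa (inj₁ pb) = inj₁ (*-pos pa pb)
  pos*nonneg⇒nonneg {a} pa (inj₂ 0≈b) = inj₂ (trans (sym (zeroʳ a)) (*-congˡ 0≈b))

  pos*nonneg≈0⇒ʳ≈0 : ∀ {a b} → 0# < a → NonNegative b → a * b ≈ 0# → b ≈ 0#
  pos*nonneg≈0⇒ʳ≈0 pa (inj₁ pb) ab≈0 = ⊥-elim (irrefl (sym ab≈0) (*-pos pa pb))
  pos*nonneg≈0⇒ʳ≈0 pa (inj₂ 0≈b) _   = sym 0≈b

  ι-nonneg : ∀ n → NonNegative (ι F n)
  ι-nonneg zero    = inj₂ ≈-refl
  ι-nonneg (suc n) = inj₁ (pos+nonneg⇒pos 0<1 (ι-nonneg n))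

  ι≈0⇒≡0 : ∀ n → ι F n ≈ 0# → n ≡ 0
  ι≈0⇒≡0 zero      _     = refl
  ι≈0⇒≡0 (suc n) ιn≈0 = ⊥-elim (irrefl (sym ιn≈0) (pos+nonneg⇒pos 0<1 (ι-nonneg n)))

  ι1≈1 : ι F 1 ≈ 1#
  ι1≈1 = +-identityʳ 1#

  mutual-excess≈0 : ∀ {a b p q} → a ≈ b + p → b ≈ a + q →
                    NonNegative p → NonNegative q → p ≈ 0# × q ≈ 0#
  mutual-excess≈0 {a} {b} {p} {q} a≈b+p b≈a+q np nq =
    nonneg+nonneg≈0⇒ʳ≈0 nq np q+p≈0 , nonneg+nonneg≈0⇒ˡ≈0 nq np q+p≈0
    where
    q+p≈0 : q + p ≈ 0#
    q+p≈0 = sym (∙-cancelˡ a 0# (q + p) (begin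
      a + 0#         ≈⟨ +-identityʳ a ⟩
      a              ≈⟨ a≈b+p ⟩
      b + p          ≈⟨ +-congʳ b≈a+q ⟩
      (a + q) + p    ≈⟨ +-assoc a q p ⟩
      a + (q + p)    ∎))

  module _ {A : Set} where

    Σ-─ : ∀ {L s} (f : A → Carrier) (p : s ∈ L) → Σ[_]_ F L f ≈ f s + Σ[_]_ F (L ─ p) f
    Σ-─ f (here refl) = ≈-refl
    Σ-─ {b ∷ L} {s} f (there p) = begin
      f b + Σ[_]_ F L f               ≈⟨ +-congˡ (Σ-─ f p) ⟩
      f b + (f s + Σ[_]_ F (L ─ p) f) ≈⟨ x∙yz≈y∙xz (f b) (f s) _ ⟩
      f s + (f b + Σ[_]_ F (L ─ p) f) ∎

    Σ-zero : ∀ {L} (f : A → Carrier) → All (λ a → f a ≈ 0#) L → Σ[_]_ F L f ≈ 0#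
    Σ-zero f []             = ≈-refl
    Σ-zero f (fa≈0 ∷ all≈0) = trans (+-cong fa≈0 (Σ-zero f all≈0)) (+-identityʳ 0#)

    Σ-nonneg : ∀ {L} (f : A → Carrier) → All (λ a → NonNegative (f a)) L →
               NonNegative (Σ[_]_ F L f)
    Σ-nonneg f []         = inj₂ ≈-refl
    Σ-nonneg f (nfa ∷ nf) = nonneg+nonneg⇒nonneg nfa (Σ-nonneg f nf)

    Σ-nonneg≈0⇒All≈0 : ∀ {L} (f : A → Carrier) → All (λ a → NonNegative (f a)) L →
                       Σ[_]_ F L f ≈ 0# → All (λ a → f a ≈ 0#) L
    Σ-nonneg≈0⇒All≈0 f []         _    = []
    Σ-nonneg≈0⇒All≈0 f (nfa ∷ nf) Σ≈0 =
      nonneg+nonneg≈0⇒ˡ≈0 nfa (Σ-nonneg f nf) Σ≈0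
        ∷ Σ-nonneg≈0⇒All≈0 f nf (nonneg+nonneg≈0⇒ʳ≈0 nfa (Σ-nonneg f nf) Σ≈0)

  module _ {d : ℕ} where

    weighted : (Mon d → Carrier) → Fin d → Mon d → Carrier
    weighted w i a = w a * ι F (lookup a i)

    weighted-σX : ∀ w i → weighted w i (σX d) ≈ w (σX d)
    weighted-σX w i rewrite lookup-replicate i 1 = trans (*-congˡ ι1≈1) (*-identityʳ _)

    Σ-weighted-split : ∀ {L} w i (p : σX d ∈ L) →
                       Σ[_]_ F L (weighted w i) ≈ w (σX d) + Σ[_]_ F (L ─ p) (weighted w i)
    Σ-weighted-split w i p = trans (Σ-─ (weighted w i) p) (+-congʳ (weighted-σX w i))

    Σ-weighted-σX-only : ∀ {L} w i (p : σX d ∈ L) → All (λ a → lookup a i ≡ 0) (L ─ p) →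
                         Σ[_]_ F L (weighted w i) ≈ w (σX d)
    Σ-weighted-σX-only {L} w i p vanish = begin
      Σ[_]_ F L (weighted w i)                      ≈⟨ Σ-weighted-split w i p ⟩
      w (σX d) + Σ[_]_ F (L ─ p) (weighted w i)     ≈⟨ +-congˡ (Σ-zero _ (All.map weighted-zero vanish)) ⟩
      w (σX d) + 0#                                 ≈⟨ +-identityʳ _ ⟩
      w (σX d)                                      ∎
      where
      weighted-zero : ∀ {a} → lookup a i ≡ 0 → weighted w i a ≈ 0#
      weighted-zero {a} ai≡0 rewrite ai≡0 = zeroʳ (w a)

    Σ-weighted-nonneg : ∀ {L} w i → All (λ a → 0# < w a) L → NonNegative (Σ[_]_ F L (weighted w i))
    Σ-weighted-nonneg w i pos =
      Σ-nonneg _ (All.map (λ {a} pa → pos*nonneg⇒nonneg pa (ι-nonneg (lookup a i))) pos)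

    Σ-weighted≈0⇒vanishing : ∀ {L} w i → All (λ a → 0# < w a) L →
                             Σ[_]_ F L (weighted w i) ≈ 0# → All (λ a → lookup a i ≡ 0) L
    Σ-weighted≈0⇒vanishing w i pos Σ≈0 =
      All.zipWith vanishing (pos , Σ-nonneg≈0⇒All≈0 _ (All.map nonneg pos) Σ≈0)
      where
      nonneg : ∀ {a} → 0# < w a → NonNegative (weighted w i a)
      nonneg {a} pa = pos*nonneg⇒nonneg pa (ι-nonneg (lookup a i))
      vanishing : ∀ {a} → 0# < w a × weighted w i a ≈ 0# → lookup a i ≡ 0
      vanishing {a} (pa , wa≈0) =
        ι≈0⇒≡0 (lookup a i) (pos*nonneg≈0⇒ʳ≈0 pa (ι-nonneg (lookup a i)) wa≈0)

lemma6p2 : ∀ {c ℓ₁ ℓ₂} (F : OrderedField c ℓ₁ ℓ₂) (n : ℕ) →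
    let open OrderedField F
        d = suc n
        s = σX d
    in (A B : List (Mon d)) →
       Unique A → Unique B → All InTX A → All InTX B →
       s ∈ A → s ∈ B →
       (x y : Fin d) →
       (∀ a → a ∈ A → a ≢ s → lookup a x ≡ 0) →
       (∀ b → b ∈ B → b ≢ s → lookup b y ≡ 0) →
       (k l : Mon d → Carrier) →
       (∀ a → a ∈ A → 0# < k a) →
       (∀ b → b ∈ B → 0# < l b) →
       (∀ (i : Fin d) →
          Σ[_]_ F A (λ a → k a * ι F (lookup a i))
            ≈ Σ[_]_ F B (λ b → l b * ι F (lookup b i))) →
       (∀ a → a ∈ A → a ≢ s → (lookup a x ≡ 0 × lookup a y ≡ 0))
       × (∀ b → b ∈ B → b ≢ s → (lookup b x ≡ 0 × lookup b y ≡ 0))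
       × (k s ≈ l s)
lemma6p2 F n A B uA uB _ _ sA sB x y hA hB k l kp lp eq =
  (λ a m a≢s → hA a m a≢s , All-─⇒∀≢ sA A′-y≡0 a m a≢s) ,
  (λ b m b≢s → All-─⇒∀≢ sB B′-x≡0 b m b≢s , hB b m b≢s) ,
  trans ks≈ls+P (trans (+-congˡ P≈0) (+-identityʳ _))
  where
  open OrderedField F
  open OrderedFieldProperties F
  s : Mon (suc n)
  s = σX (suc n)
  A′ B′ : List (Mon (suc n))
  A′ = A ─ sA
  B′ = B ─ sB
  P Q : Carrier
  P = Σ[_]_ F B′ (weighted l x)
  Q = Σ[_]_ F A′ (weighted k y)
  ks≈ls+P : k s ≈ l s + P
  ks≈ls+P = trans (sym (Σ-weighted-σX-only k x sA (Unique⇒All-─ uA sA hA)))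
                  (trans (eq x) (Σ-weighted-split l x sB))
  ls≈ks+Q : l s ≈ k s + Q
  ls≈ks+Q = trans (sym (Σ-weighted-σX-only l y sB (Unique⇒All-─ uB sB hB)))
                  (trans (sym (eq y)) (Σ-weighted-split k y sA))
  k-pos : All (λ a → 0# < k a) A′
  k-pos = ─⁺ sA (All.tabulate (kp _))
  l-pos : All (λ b → 0# < l b) B′
  l-pos = ─⁺ sB (All.tabulate (lp _))
  P≈0×Q≈0 : P ≈ 0# × Q ≈ 0#
  P≈0×Q≈0 = mutual-excess≈0 ks≈ls+P ls≈ks+Q (Σ-weighted-nonneg l x l-pos) (Σ-weighted-nonneg k y k-pos)
  P≈0 : P ≈ 0#
  P≈0 = proj₁ P≈0×Q≈0
  B′-x≡0 : All (λ b → lookup b x ≡ 0) B′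
  B′-x≡0 = Σ-weighted≈0⇒vanishing l x l-pos P≈0
  A′-y≡0 : All (λ a → lookup a y ≡ 0) A′
  A′-y≡0 = Σ-weighted≈0⇒vanishing k y k-pos (proj₂ P≈0×Q≈0)
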